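{- Let $H$ be a graph containing adjacent vertices $u,v$, and let $H'=H-\{u,v\}$ be $4$-colorable. Suppose $u$ has exactly one neighbor $x$ in $V(H')$ and $v$ has exactly one neighbor $y$ in $V(H')$, with $y\neq x$. Let $\phi$ and $\phi'$ be proper $4$-colorings of $H'$ adjacent in $G^1_4(H')$, and let $G$ be the subgraph of $G^1_4(H)$ induced by the proper $4$-colorings of $H$ whose restriction to $H'$ is $\phi$. Then for every $\pi\in V(G)$ there exists $\rho\in V(G)\setminus\{\pi\}$ such that $G$ has a Hamiltonian path from $\pi$ to $\rho$ and $\rho$ is adjacent in $G^1_4(H)$ to some proper $4$-coloring of $H$ whose restriction to $H'$ is $\phi'$.
   Context: For a graph $H$ and $k\geq\chi(H)$, a proper $k$-coloring is a map $V(H)\to[k]$ giving adjacent vertices different colors. $G^1_k(H)$ is the graph whose vertices are the proper $k$-colorings of $H$, two colorings being adjacent if they differ on exactly one vertex. -}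

module Defs where

open import Data.Nat using (ℕ; suc)
open import Data.Fin using (Fin; zero; suc)
open import Data.Bool using (Bool; true; false)
open import Data.Vec using (Vec; lookup; tail)
open import Data.List using (List; head; last)
open import Data.Maybe using (just)
open import Data.Product using (Σ; _×_; ∃)
open import Data.List.Relation.Unary.All using (All)
open import Data.List.Relation.Unary.Linked using (Linked)
open import Data.List.Relation.Unary.Unique.Propositional using (Unique)
open import Data.List.Membership.Propositional using (_∈_)
open import Relation.Binary.PropositionalEquality using (_≡_; _≢_)
open import Relation.Nullary using (¬_)

record Graph (n : ℕ) : Set where
  field
    adj    : Fin n → Fin n → Bool
    sym    : ∀ x y → adj x y ≡ adj y x
    irrefl : ∀ x → adj x x ≡ false

open Graph public

Edge : ∀ {n} → Graph n → Fin n → Fin n → Set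
Edge H x y = adj H x y ≡ true

Coloring : ℕ → ℕ → Set
Coloring k n = Vec (Fin k) n

Proper : ∀ {n k} → Graph n → Coloring k n → Set
Proper H c = ∀ x y → Edge H x y → lookup c x ≢ lookup c y

Colorable : ∀ {n} → ℕ → Graph n → Set
Colorable {n} k H = Σ (Coloring k n) (Proper H)

DifferOnExactlyOne : ∀ {n k} → Coloring k n → Coloring k n → Set
DifferOnExactlyOne {n} c d =
  Σ (Fin n) λ i → (lookup c i ≢ lookup d i) × (∀ j → j ≢ i → lookup c j ≡ lookup d j)

AdjG1 : ∀ {n} (k : ℕ) → Graph n → Coloring k n → Coloring k n → Set
AdjG1 k H c d = Proper H c × Proper H d × DifferOnExactlyOne c d

-- Convention: H has vertex set Fin (2 + m), with u = vertex 0 and v = vertex 1.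
-- H' = H - {u,v} is the induced subgraph on the remaining vertices,
-- where vertex i of H' is vertex (suc (suc i)) of H.
delete01 : ∀ {m} → Graph (suc (suc m)) → Graph m
delete01 H = record
  { adj    = λ i j → adj H (suc (suc i)) (suc (suc j))
  ; sym    = λ i j → sym H (suc (suc i)) (suc (suc j))
  ; irrefl = λ i → irrefl H (suc (suc i))
  }

restrict : ∀ {m k} → Coloring k (suc (suc m)) → Coloring k m
restrict c = tail (tail c)

record HamiltonianPath {A : Set} (V : A → Set) (Adj : A → A → Set) (s t : A) : Set where
  field
    path     : List A
    starts   : head path ≡ just s
    ends     : last path ≡ just t
    linked   : Linked Adj path
    inV      : All V path
    covers   : ∀ a → V a → a ∈ path
    distinct : Unique path

module Submission where

-- Every proper colouring of H restricting to φ is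
-- φ extended by a pair (p , q) of colours for u and v, and it is proper
-- exactly when p ≠ φ(x), q ≠ φ(y) and p ≠ q ("admissible" pairs), since x
-- and y are the only neighbours of u and v outside {u,v}.  Two such
-- extensions are adjacent in G¹₄(H) exactly when the pairs differ in one
-- coordinate.  So the fibre G is isomorphic to a graph on at most 16 colour
-- pairs that depends only on a = φ(x), b = φ(y).  As φ and φ′ differ at a
-- single vertex and x ≠ y, we have φ′(x) = a or φ′(y) = b.

open import Defs
open import Data.Nat using (ℕ; suc)
open import Data.Fin using (Fin; zero; suc)
open import Data.Fin.Properties using (all?) renaming (_≟_ to _≟F_)
open import Data.Bool using (if_then_else_)
open import Data.Product using (Σ; _×_; _,_)
open import Data.Product.Properties using (≡-dec)
open import Data.Sum using (_⊎_; inj₁; inj₂)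
open import Data.Empty using (⊥; ⊥-elim)
open import Data.Vec using (lookup; _∷_)
open import Data.List using (List; []; _∷_; [_]; head; last; map; filter; concatMap; allFin)
import Data.Maybe as Maybe
open import Data.Maybe using (Maybe; just; nothing; fromMaybe)
import Data.Maybe.Properties as Maybe
open import Data.List.Properties using (head-map; last-map)
open import Data.List.Relation.Unary.All using (All; []; _∷_) renaming (all? to allL?; map to all-map)
open import Data.List.Relation.Unary.All.Properties using () renaming (map⁺ to all-map⁺)
open import Data.List.Relation.Unary.Linked using (Linked; []; [-]; _∷_; linked?)
open import Data.List.Relation.Unary.Unique.Propositional using (Unique)
import Data.List.Relation.Unary.Unique.Propositional.Properties as Unique
open import Data.List.Membership.Propositional using (_∈_)
open import Data.List.Membership.Propositional.Properties using (∈-map⁺)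
open import Relation.Binary.PropositionalEquality using (_≡_; _≢_; refl; trans; cong) renaming (sym to ≡-sym)
open import Relation.Nullary using (Dec; yes; no; does)
open import Relation.Nullary.Decidable using (¬?; _×-dec_; _⊎-dec_; _→-dec_; toWitness)

module _ {A B : Set} {V : A → Set} {Adj : A → A → Set} {W : B → Set} {Adj′ : B → B → Set}
         (f : A → B)
         (f-injective : ∀ {a a′} → f a ≡ f a′ → a ≡ a′)
         (f-vertex : ∀ {a} → V a → W (f a))
         (f-edge : ∀ {a a′} → V a → V a′ → Adj a a′ → Adj′ (f a) (f a′))
         (f-onto : ∀ {b} → W b → Σ A λ a → V a × f a ≡ b) where

  linked-map : ∀ {L} → All V L → Linked Adj L → Linked Adj′ (map f L)
  linked-map _ [] = []
  linked-map _ [-] = [-]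
  linked-map (va ∷ va′ ∷ vs) (e ∷ es) = f-edge va va′ e ∷ linked-map (va′ ∷ vs) es

  map-hamiltonian : ∀ {s t} → HamiltonianPath V Adj s t → HamiltonianPath W Adj′ (f s) (f t)
  map-hamiltonian P = record
    { path     = map f path
    ; starts   = trans (head-map {f = f} path) (cong (Maybe.map f) starts)
    ; ends     = trans (last-map f path) (cong (Maybe.map f) ends)
    ; linked   = linked-map inV linked
    ; inV      = all-map⁺ (all-map f-vertex inV)
    ; covers   = covers′
    ; distinct = Unique.map⁺ f-injective distinct
    }
    where
    open HamiltonianPath P
    covers′ : ∀ b → W b → b ∈ map f path
    covers′ b wb with f-onto wb
    ... | a , va , refl = ∈-map⁺ f (covers a va)

ColourPair : ℕ → Set
ColourPair k = Fin k × Fin k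

Admissible : ∀ {k} → Fin k → Fin k → ColourPair k → Set
Admissible a b (p , q) = p ≢ a × q ≢ b × p ≢ q

PairStep : ∀ {k} → ColourPair k → ColourPair k → Set
PairStep (p , q) (p′ , q′) = (p ≡ p′ × q ≢ q′) ⊎ (p ≢ p′ × q ≡ q′)

FibreSolution : Fin 4 → Fin 4 → Fin 4 → Fin 4 → ColourPair 4 → Set
FibreSolution a b a′ b′ s =
  Σ (ColourPair 4) λ t →
    Admissible a b t × Admissible a′ b′ t × t ≢ s × HamiltonianPath (Admissible a b) PairStep s t

module FibreSearch where
  -- The finite fibre lemma is proved by exhibiting, for each of the finitely
  -- many cases, a path found by depth-first search, and checking it.

  _≟P_ : (r s : ColourPair 4) → Dec (r ≡ s)
  _≟P_ = ≡-dec _≟F_ _≟F_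

  open import Data.List.Relation.Unary.Unique.DecPropositional _≟P_ using (unique?)
  open import Data.List.Membership.DecPropositional _≟P_ using (_∈?_)

  admissible? : (a b : Fin 4) (r : ColourPair 4) → Dec (Admissible a b r)
  admissible? a b (p , q) = ¬? (p ≟F a) ×-dec ¬? (q ≟F b) ×-dec ¬? (p ≟F q)

  step? : ∀ r s → Dec (PairStep {4} r s)
  step? (p , q) (p′ , q′) = ((p ≟F p′) ×-dec ¬? (q ≟F q′)) ⊎-dec (¬? (p ≟F p′) ×-dec (q ≟F q′))

  GoodEnd : Fin 4 → Fin 4 → Fin 4 → Fin 4 → ColourPair 4 → Maybe (ColourPair 4) → Set
  GoodEnd a b a′ b′ s nothing = ⊥
  GoodEnd a b a′ b′ s (just t) = Admissible a b t × Admissible a′ b′ t × t ≢ s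

  goodEnd? : (a b a′ b′ : Fin 4) (s : ColourPair 4) (mt : Maybe (ColourPair 4)) → Dec (GoodEnd a b a′ b′ s mt)
  goodEnd? a b a′ b′ s nothing = no λ ()
  goodEnd? a b a′ b′ s (just t) = admissible? a b t ×-dec admissible? a′ b′ t ×-dec ¬? (t ≟P s)

  Certificate : Fin 4 → Fin 4 → Fin 4 → Fin 4 → ColourPair 4 → List (ColourPair 4) → Set
  Certificate a b a′ b′ s L =
    head L ≡ just s × GoodEnd a b a′ b′ s (last L) × Linked PairStep L ×
    All (Admissible a b) L × (∀ p q → Admissible a b (p , q) → (p , q) ∈ L) × Unique L

  certificate? : (a b a′ b′ : Fin 4) (s : ColourPair 4) (L : List (ColourPair 4)) →
                 Dec (Certificate a b a′ b′ s L)
  certificate? a b a′ b′ s L =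
    Maybe.≡-dec _≟P_ (head L) (just s) ×-dec goodEnd? a b a′ b′ s (last L) ×-dec linked? step? L ×-dec
    allL? (admissible? a b) L ×-dec
    all? (λ p → all? λ q → admissible? a b (p , q) →-dec ((p , q) ∈? L)) ×-dec unique? L

  certificate⇒solution : ∀ {a b a′ b′ s} L → Certificate a b a′ b′ s L → FibreSolution a b a′ b′ s
  certificate⇒solution L (starts , end , linked , inV , covers , distinct)
    with last L in ends | end
  ... | just t | t-adm , t-adm′ , t≢s =
    t , t-adm , t-adm′ , t≢s ,
    record { path = L ; starts = starts ; ends = ends ; linked = linked ; inV = inV
           ; covers = λ r → covers _ _ ; distinct = distinct }

  allPairs : List (ColourPair 4)
  allPairs = concatMap (λ p → map (p ,_) (allFin 4)) (allFin 4)

  remove : ColourPair 4 → List (ColourPair 4) → List (ColourPair 4)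
  remove w = filter (λ r → ¬? (r ≟P w))

  -- All orderings of `rest` forming a PairStep-path that may follow `cur`
  -- (the fuel bounds the length of `rest`).
  pathsThrough : ℕ → ColourPair 4 → List (ColourPair 4) → List (List (ColourPair 4))
  pathsThrough _ cur [] = [ [] ]
  pathsThrough (suc n) cur rest@(_ ∷ _) =
    concatMap (λ w → if does (step? cur w) then map (w ∷_) (pathsThrough n w (remove w rest)) else []) rest
  pathsThrough _ _ _ = []

  search : Fin 4 → Fin 4 → Fin 4 → Fin 4 → ColourPair 4 → List (ColourPair 4)
  search a b a′ b′ s =
    fromMaybe [] (head (filter (λ L → goodEnd? a b a′ b′ s (last L))
      (map (s ∷_) (pathsThrough 16 s (remove s (filter (admissible? a b) allPairs))))))

  AllCasesCertified : Set
  AllCasesCertified = (a b a′ b′ p q : Fin 4) → (a′ ≡ a ⊎ b′ ≡ b) → Admissible a b (p , q) →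
    Certificate a b a′ b′ (p , q) (search a b a′ b′ (p , q))

  allCasesCertified : AllCasesCertified
  allCasesCertified = toWitness {a? = decide} _
    where
    decide : Dec AllCasesCertified
    decide = all? λ a → all? λ b → all? λ a′ → all? λ b′ → all? λ p → all? λ q →
      ((a′ ≟F a) ⊎-dec (b′ ≟F b)) →-dec
      (admissible? a b (p , q) →-dec certificate? a b a′ b′ (p , q) (search a b a′ b′ (p , q)))

fibre-lemma : (a b a′ b′ : Fin 4) → (a′ ≡ a ⊎ b′ ≡ b) → ∀ s → Admissible a b s → FibreSolution a b a′ b′ s
fibre-lemma a b a′ b′ same s adm =
  certificate⇒solution (search a b a′ b′ s) (allCasesCertified a b a′ b′ _ _ same adm)
  where open FibreSearch

extend : ∀ {k m} → Coloring k m → ColourPair k → Coloring k (suc (suc m))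
extend ψ (p , q) = p ∷ q ∷ ψ

extend-injective : ∀ {k m} (ψ : Coloring k m) {r s} → extend ψ r ≡ extend ψ s → r ≡ s
extend-injective ψ {p , q} {p′ , q′} refl = refl

step⇒differ : ∀ {k m} (ψ : Coloring k m) {r s} → PairStep r s →
              DifferOnExactlyOne (extend ψ r) (extend ψ s)
step⇒differ ψ {p , q} {.p , q′} (inj₁ (refl , q≢q′)) = suc zero , q≢q′ , agree
  where
  agree : ∀ j → j ≢ suc zero → lookup (extend ψ (p , q)) j ≡ lookup (extend ψ (p , q′)) j
  agree zero _ = refl
  agree (suc zero) j≢v = ⊥-elim (j≢v refl)
  agree (suc (suc _)) _ = refl
step⇒differ ψ {p , q} {p′ , .q} (inj₂ (p≢p′ , refl)) = zero , p≢p′ , agree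
  where
  agree : ∀ j → j ≢ zero → lookup (extend ψ (p , q)) j ≡ lookup (extend ψ (p′ , q)) j
  agree zero j≢u = ⊥-elim (j≢u refl)
  agree (suc _) _ = refl

extend-differ : ∀ {k m} {ψ ψ′ : Coloring k m} r → DifferOnExactlyOne ψ ψ′ →
                DifferOnExactlyOne (extend ψ r) (extend ψ′ r)
extend-differ {ψ = ψ} {ψ′} r (z , ψz≢ψ′z , agree) = suc (suc z) , ψz≢ψ′z , agree′
  where
  agree′ : ∀ j → j ≢ suc (suc z) → lookup (extend ψ r) j ≡ lookup (extend ψ′ r) j
  agree′ zero _ = refl
  agree′ (suc zero) _ = refl
  agree′ (suc (suc j)) j≢z = agree j λ j≡z → j≢z (cong (λ i → suc (suc i)) j≡z)

differ-one-side : ∀ {k m} (ψ ψ′ : Coloring k m) {x y} → y ≢ x → DifferOnExactlyOne ψ ψ′ →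
                  lookup ψ′ x ≡ lookup ψ x ⊎ lookup ψ′ y ≡ lookup ψ y
differ-one-side ψ ψ′ {x} {y} y≢x (z , _ , agree) with x ≟F z
... | yes refl = inj₂ (≡-sym (agree y y≢x))
... | no x≢z = inj₁ (≡-sym (agree x x≢z))

module Pendant {m} (H : Graph (suc (suc m)))
  (e01 : Edge H zero (suc zero))
  (x y : Fin m)
  (ex : Edge H zero (suc (suc x))) (ux : ∀ w → Edge H zero (suc (suc w)) → w ≡ x)
  (ey : Edge H (suc zero) (suc (suc y))) (uy : ∀ w → Edge H (suc zero) (suc (suc w)) → w ≡ y) where

  InFibre : ∀ {k} → Coloring k m → Coloring k (suc (suc m)) → Set
  InFibre ψ c = Proper H c × restrict c ≡ ψ

  private
    no-loop : ∀ {i} → Edge H i i → ⊥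
    no-loop {i} e with trans (≡-sym e) (irrefl H i)
    ... | ()

    flip-edge : ∀ {i j} → Edge H i j → Edge H j i
    flip-edge {i} {j} e = trans (sym H j i) e

  extend-proper : ∀ {k} (ψ : Coloring k m) → Proper (delete01 H) ψ →
                  ∀ r → Admissible (lookup ψ x) (lookup ψ y) r → Proper H (extend ψ r)
  extend-proper ψ Pψ (p , q) (p≢a , q≢b , p≢q) = proper
    where
    proper : Proper H (extend ψ (p , q))
    proper zero zero e = ⊥-elim (no-loop e)
    proper zero (suc zero) _ = p≢q
    proper (suc zero) zero _ = λ q≡p → p≢q (≡-sym q≡p)
    proper (suc zero) (suc zero) e = ⊥-elim (no-loop e)
    proper zero (suc (suc w)) e with ux w e
    ... | refl = p≢a
    proper (suc (suc w)) zero e with ux w (flip-edge e)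
    ... | refl = λ a≡p → p≢a (≡-sym a≡p)
    proper (suc zero) (suc (suc w)) e with uy w e
    ... | refl = q≢b
    proper (suc (suc w)) (suc zero) e with uy w (flip-edge e)
    ... | refl = λ b≡q → q≢b (≡-sym b≡q)
    proper (suc (suc i)) (suc (suc j)) e = Pψ i j e

  fibre-onto : ∀ {k} (ψ : Coloring k m) {c} → InFibre ψ c →
               Σ (ColourPair k) λ r → Admissible (lookup ψ x) (lookup ψ y) r × extend ψ r ≡ c
  fibre-onto ψ {p ∷ q ∷ .ψ} (Pc , refl) =
    (p , q) , (Pc zero (suc (suc x)) ex , Pc (suc zero) (suc (suc y)) ey , Pc zero (suc zero) e01) , refl

  fibre-hamiltonian : ∀ {k} (ψ : Coloring k m) → Proper (delete01 H) ψ → ∀ {s t} →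
    HamiltonianPath (Admissible (lookup ψ x) (lookup ψ y)) PairStep s t →
    HamiltonianPath (InFibre ψ) (AdjG1 k H) (extend ψ s) (extend ψ t)
  fibre-hamiltonian ψ Pψ = map-hamiltonian (extend ψ) (extend-injective ψ)
    (λ {r} adm → extend-proper ψ Pψ r adm , refl)
    (λ {r} {s} r-adm s-adm st → extend-proper ψ Pψ r r-adm , extend-proper ψ Pψ s s-adm , step⇒differ ψ st)
    (fibre-onto ψ)

  Conclusion : Coloring 4 m → Coloring 4 m → Coloring 4 (suc (suc m)) → Set
  Conclusion φ φ′ π =
    Σ (Coloring 4 (suc (suc m))) λ ρ →
      InFibre φ ρ × ρ ≢ π × HamiltonianPath (InFibre φ) (AdjG1 4 H) π ρ ×
      Σ (Coloring 4 (suc (suc m))) λ σ →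
        Proper H σ × restrict σ ≡ φ′ × AdjG1 4 H ρ σ

  -- A solution of the finite fibre lemma yields the theorem: the path ends at
  -- ρ = extend φ t, and σ = extend φ′ t is proper and differs from ρ only where φ′ differs from φ.
  solution⇒conclusion : ∀ {φ φ′} → Proper (delete01 H) φ → Proper (delete01 H) φ′ →
    DifferOnExactlyOne φ φ′ → ∀ s →
    FibreSolution (lookup φ x) (lookup φ y) (lookup φ′ x) (lookup φ′ y) s → Conclusion φ φ′ (extend φ s)
  solution⇒conclusion {φ} {φ′} Pφ Pφ′ φ~φ′ s (t , t-adm , t-adm′ , t≢s , path) =
    extend φ t , (Pρ , refl) , (λ ρ≡π → t≢s (extend-injective φ ρ≡π)) ,
    fibre-hamiltonian φ Pφ path ,
    extend φ′ t , Pσ , refl , (Pρ , Pσ , extend-differ t φ~φ′)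
    where
    Pρ : Proper H (extend φ t)
    Pρ = extend-proper φ Pφ t t-adm
    Pσ : Proper H (extend φ′ t)
    Pσ = extend-proper φ′ Pφ′ t t-adm′

mainTheorem13 : (m : ℕ) (H : Graph (suc (suc m))) →
    Edge H zero (suc zero) →
    Colorable 4 (delete01 H) →
    (x y : Fin m) →
    Edge H zero (suc (suc x)) → (∀ w → Edge H zero (suc (suc w)) → w ≡ x) →
    Edge H (suc zero) (suc (suc y)) → (∀ w → Edge H (suc zero) (suc (suc w)) → w ≡ y) →
    y ≢ x →
    (φ φ′ : Coloring 4 m) →
    AdjG1 4 (delete01 H) φ φ′ →
    let InG : Coloring 4 (suc (suc m)) → Set
        InG π = Proper H π × restrict π ≡ φ
    in (π : Coloring 4 (suc (suc m))) → InG π →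
       Σ (Coloring 4 (suc (suc m))) λ ρ →
         InG ρ × ρ ≢ π × HamiltonianPath InG (AdjG1 4 H) π ρ ×
         Σ (Coloring 4 (suc (suc m))) λ σ →
           Proper H σ × restrict σ ≡ φ′ × AdjG1 4 H ρ σ
mainTheorem13 m H e01 _ x y ex ux ey uy y≢x φ φ′ (Pφ , Pφ′ , φ~φ′) π π∈G
  with Pendant.fibre-onto H e01 x y ex ux ey uy φ {π} π∈G
... | s , s-adm , refl =
  solution⇒conclusion Pφ Pφ′ φ~φ′ s
    (fibre-lemma (lookup φ x) (lookup φ y) (lookup φ′ x) (lookup φ′ y) (differ-one-side φ φ′ y≢x φ~φ′) s s-adm)
  where open Pendant H e01 x y ex ux ey uy
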